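{- For every integer $r\ge 2$ and integers $1\le s_1\le s_2\le\cdots\le s_r$, $$\max_{F\subseteq K_{s_1,\ldots,s_r},\ v(F)>0}\frac{2e(F)}{v(F)}=\frac{2e(K_{s_1,\ldots,s_r})}{v(K_{s_1,\ldots,s_r})}.$$
   Context: $K_{s_1,\ldots,s_r}$ is the complete $r$-partite graph with parts of sizes $s_1,\ldots,s_r$; the maximum is over its subgraphs $F$ with at least one vertex; $v(\cdot)$, $e(\cdot)$ are the numbers of vertices and edges. -}

module Defs where

open import Data.Nat using (ℕ; zero; suc; _+_; _*_; _<_; >-nonZero)
open import Data.Bool using (Bool; true; false; T; not)
open import Data.Fin using (Fin; _≟_)
open import Data.Product using (Σ; _×_; _,_; proj₁; proj₂)
open import Data.List using (List; []; _∷_; map; _++_; concatMap; length; allFin)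
open import Data.Integer using (+_)
open import Data.Rational using (ℚ; _/_)
open import Relation.Nullary.Decidable using (isYes)
open import Relation.Binary.PropositionalEquality using (_≡_; _≢_)

Vtx : (r : ℕ) → (Fin r → ℕ) → Set
Vtx r s = Σ (Fin r) (λ i → Fin (s i))

allV : (r : ℕ) (s : Fin r → ℕ) → List (Vtx r s)
allV r s = concatMap (λ i → map (λ j → (i , j)) (allFin (s i))) (allFin r)

pairsOf : {A : Set} → List A → List (A × A)
pairsOf [] = []
pairsOf (x ∷ xs) = map (λ y → (x , y)) xs ++ pairsOf xs

countB : {A : Set} → (A → Bool) → List A → ℕ
countB p [] = 0
countB p (x ∷ xs) = (if p x then 1 else 0) + countB p xs
  where
  open import Data.Bool using (if_then_else_)

adjK : {r : ℕ} {s : Fin r → ℕ} → Vtx r s → Vtx r s → Bool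
adjK u v = not (isYes (proj₁ u ≟ proj₁ v))

record Subgraph (r : ℕ) (s : Fin r → ℕ) : Set where
  field
    inV   : Vtx r s → Bool
    inE   : Vtx r s → Vtx r s → Bool
    symE  : ∀ u v → inE u v ≡ inE v u
    edgeK : ∀ u v → T (inE u v) → T (adjK u v)
    endL  : ∀ u v → T (inE u v) → T (inV u)
    endR  : ∀ u v → T (inE u v) → T (inV v)

open Subgraph public

vF : {r : ℕ} {s : Fin r → ℕ} → Subgraph r s → ℕ
vF {r} {s} F = countB (inV F) (allV r s)

eF : {r : ℕ} {s : Fin r → ℕ} → Subgraph r s → ℕ
eF {r} {s} F = countB (λ p → inE F (proj₁ p) (proj₂ p)) (pairsOf (allV r s))

vK : (r : ℕ) (s : Fin r → ℕ) → ℕ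
vK r s = length (allV r s)

eK : (r : ℕ) (s : Fin r → ℕ) → ℕ
eK r s = countB (λ p → adjK (proj₁ p) (proj₂ p)) (pairsOf (allV r s))

ratio2 : (e v : ℕ) → 0 < v → ℚ
ratio2 e v p = (+ (2 * e) / v) {{>-nonZero p}}

-- In a complete multipartite graph non-adjacent vertices have the same neighbourhood.
-- Hence for any vertex x and vertex list Z, every edge of Z has an endpoint adjacent
-- to x, so e(Z) ≤ deg_Z(x) · |Z|: adding x to Z never lowers the density e/v.
-- Inserting the missing vertices one at a time, the induced subgraph on any vertex set
-- is at most as dense as K, and a subgraph has at most the edges of the induced one.
module Submission where

open import Defs
open import Data.Bool using (Bool; true; false; T; _∧_; if_then_else_)
open import Data.Bool.Properties using (T-∧)
open import Data.Empty using (⊥-elim)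
open import Data.Fin using (Fin; _≟_) renaming (_≤_ to _≤F_)
open import Data.Integer as ℤ using (+≤+)
open import Data.Integer.Properties using (pos-*)
open import Data.List using (List; []; _∷_; _++_; [_]; map; length; filterᵇ)
open import Data.List.Properties using (++-assoc; length-++-sucʳ)
open import Data.List.Relation.Binary.Sublist.Propositional using (_⊆_; []; _∷_; _∷ʳ_)
open import Data.List.Relation.Binary.Sublist.Propositional.Properties using (filter-⊆)
open import Data.Nat using (ℕ; suc; _+_; _*_; _≤_; _<_; z≤n; s≤s; NonZero)
open import Data.Nat.Properties
  using ( +-assoc; *-assoc; *-suc; *-distribʳ-+; ≤-refl; ≤-trans; ≤-reflexive; n≤1+n; m≤n⇒m≤1+n
        ; +-mono-≤; +-monoˡ-≤; *-monoˡ-≤; *-monoʳ-≤; *-cancelʳ-≤; module ≤-Reasoning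
        ; +-commutativeSemigroup; *-commutativeSemigroup )
open import Algebra.Properties.CommutativeSemigroup +-commutativeSemigroup using (interchange; x∙yz≈y∙xz)
open import Algebra.Properties.CommutativeSemigroup *-commutativeSemigroup using (xy∙z≈xz∙y)
open import Data.Product using (Σ; _×_; _,_; proj₁; uncurry′)
open import Data.Rational using () renaming (_≤_ to _≤ℚ_)
open import Data.Rational.Properties using (toℚᵘ-cancel-≤; toℚᵘ-fromℚᵘ)
open import Data.Rational.Unnormalised as ℚᵘ using (mkℚᵘ; *≤*)
open import Data.Rational.Unnormalised.Properties using (≤-respˡ-≃; ≤-respʳ-≃; ≃-sym)
open import Data.Unit using (tt)
open import Function using (_∘_; Equivalence)
open import Relation.Binary.PropositionalEquality
  using (_≡_; refl; sym; trans; cong; cong₂; subst; subst₂; module ≡-Reasoning)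
open import Relation.Nullary using (¬_; yes; no)
open import Relation.Nullary.Decidable using (T?)

private
  variable
    A B : Set

countB-++ : (p : A → Bool) (xs ys : List A) → countB p (xs ++ ys) ≡ countB p xs + countB p ys
countB-++ p []       ys = refl
countB-++ p (x ∷ xs) ys =
  trans (cong ((if p x then 1 else 0) +_) (countB-++ p xs ys)) (sym (+-assoc (if p x then 1 else 0) _ _))

countB-map : (p : B → Bool) (f : A → B) (xs : List A) → countB p (map f xs) ≡ countB (p ∘ f) xs
countB-map p f []       = refl
countB-map p f (x ∷ xs) = cong ((if p (f x) then 1 else 0) +_) (countB-map p f xs)

countB-pairsOf-∷ : (R : A → A → Bool) (x : A) (xs : List A) →
                   countB (uncurry′ R) (pairsOf (x ∷ xs)) ≡ countB (R x) xs + countB (uncurry′ R) (pairsOf xs)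
countB-pairsOf-∷ R x xs =
  trans (countB-++ (uncurry′ R) (map (x ,_) xs) (pairsOf xs)) (cong (_+ _) (countB-map (uncurry′ R) (x ,_) xs))

countB≤length : (p : A → Bool) (xs : List A) → countB p xs ≤ length xs
countB≤length p []       = z≤n
countB≤length p (x ∷ xs) with p x
... | true  = s≤s (countB≤length p xs)
... | false = m≤n⇒m≤1+n (countB≤length p xs)

countB-insert : (p : A → Bool) (us : List A) (x : A) (vs : List A) →
                countB p (us ++ x ∷ vs) ≡ countB p (x ∷ us ++ vs)
countB-insert p []       x vs = refl
countB-insert p (u ∷ us) x vs =
  trans (cong ((if p u then 1 else 0) +_) (countB-insert p us x vs))
        (x∙yz≈y∙xz (if p u then 1 else 0) (if p x then 1 else 0) (countB p (us ++ vs)))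

countB-true : (xs : List A) → countB (λ _ → true) xs ≡ length xs
countB-true []       = refl
countB-true (x ∷ xs) = cong suc (countB-true xs)

countB-cong : {p q : A → Bool} → (∀ x → p x ≡ q x) → (xs : List A) → countB p xs ≡ countB q xs
countB-cong p≗q []       = refl
countB-cong p≗q (x ∷ xs) = cong₂ (λ b n → (if b then 1 else 0) + n) (p≗q x) (countB-cong p≗q xs)

countB-mono : {p q : A → Bool} → (∀ x → T (p x) → T (q x)) → (xs : List A) → countB p xs ≤ countB q xs
countB-mono p⇒q []       = z≤n
countB-mono {p = p} {q = q} p⇒q (x ∷ xs) with p x | q x | p⇒q x
... | true  | true  | _   = s≤s (countB-mono p⇒q xs)
... | true  | false | p⇒qx = ⊥-elim (p⇒qx tt)
... | false | true  | _   = m≤n⇒m≤1+n (countB-mono p⇒q xs)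
... | false | false | _   = countB-mono p⇒q xs

countB-none : {p : A → Bool} → (∀ x → ¬ T (p x)) → (xs : List A) → countB p xs ≡ 0
countB-none none []       = refl
countB-none {p = p} none (x ∷ xs) with p x | none x
... | true  | ¬px = ⊥-elim (¬px tt)
... | false | _   = countB-none none xs

countB-filterᵇ : (p q : A → Bool) (xs : List A) → countB p (filterᵇ q xs) ≡ countB (λ x → q x ∧ p x) xs
countB-filterᵇ p q []       = refl
countB-filterᵇ p q (x ∷ xs) with q x
... | true  = cong ((if p x then 1 else 0) +_) (countB-filterᵇ p q xs)
... | false = countB-filterᵇ p q xs

length-filterᵇ : (q : A → Bool) (xs : List A) → length (filterᵇ q xs) ≡ countB q xs
length-filterᵇ q []       = refl
length-filterᵇ q (x ∷ xs) with q x
... | true  = cong suc (length-filterᵇ q xs)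
... | false = length-filterᵇ q xs

cross-≤-trans : ∀ a b c m n k .{{_ : NonZero n}} → a * n ≤ b * m → b * k ≤ c * n → a * k ≤ c * m
cross-≤-trans a b c m n k an≤bm bk≤cn = *-cancelʳ-≤ (a * k) (c * m) n (begin
  a * k * n ≡⟨ xy∙z≈xz∙y a k n ⟩
  a * n * k ≤⟨ *-monoˡ-≤ k an≤bm ⟩
  b * m * k ≡⟨ xy∙z≈xz∙y b m k ⟩
  b * k * m ≤⟨ *-monoˡ-≤ m bk≤cn ⟩
  c * n * m ≡⟨ xy∙z≈xz∙y c n m ⟩
  c * m * n ∎)
  where open ≤-Reasoning

module CompleteMultipartite
  (adj : A → A → Bool)
  (adj-sym : ∀ x y → adj x y ≡ adj y x)
  (nonadjacent-twins : ∀ x y z → adj x y ≡ false → adj y z ≡ adj x z)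
  where

  degree : A → List A → ℕ
  degree x = countB (adj x)

  edges : List A → ℕ
  edges []       = 0
  edges (x ∷ xs) = degree x xs + edges xs

  -- e(ys)/v(ys) ≤ e(xs)/v(xs), cross-multiplied to avoid division by v = 0.
  _≼_ : List A → List A → Set
  ys ≼ xs = edges ys * length xs ≤ edges xs * length ys

  countB-pairsOf≡edges : (xs : List A) → countB (uncurry′ adj) (pairsOf xs) ≡ edges xs
  countB-pairsOf≡edges []       = refl
  countB-pairsOf≡edges (x ∷ xs) =
    trans (countB-pairsOf-∷ adj x xs) (cong (degree x xs +_) (countB-pairsOf≡edges xs))

  edges-insert : ∀ us x vs → edges (us ++ x ∷ vs) ≡ edges (x ∷ us ++ vs)
  edges-insert []       x vs = refl
  edges-insert (u ∷ us) x vs = begin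
    degree u (us ++ x ∷ vs) + edges (us ++ x ∷ vs)
      ≡⟨ cong₂ _+_ (countB-insert (adj u) us x vs) (edges-insert us x vs) ⟩
    ((if adj u x then 1 else 0) + degree u ws) + (degree x ws + edges ws)
      ≡⟨ interchange (if adj u x then 1 else 0) (degree u ws) (degree x ws) (edges ws) ⟩
    ((if adj u x then 1 else 0) + degree x ws) + (degree u ws + edges ws)
      ≡⟨ cong (λ b → ((if b then 1 else 0) + degree x ws) + edges (u ∷ ws)) (adj-sym u x) ⟩
    degree x (u ∷ ws) + edges (u ∷ ws) ∎
    where
    open ≡-Reasoning
    ws : List A
    ws = us ++ vs

  edges≤degree*length : ∀ x zs → edges zs ≤ degree x zs * length zs
  edges≤degree*length x []       = z≤n
  edges≤degree*length x (y ∷ zs) with adj x y in xy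
  ... | true  = begin
    degree y zs + edges zs              ≤⟨ +-mono-≤ (countB≤length (adj y) zs) (edges≤degree*length x zs) ⟩
    length zs + degree x zs * length zs ≤⟨ +-mono-≤ (n≤1+n _) (*-monoʳ-≤ (degree x zs) (n≤1+n _)) ⟩
    suc (degree x zs) * suc (length zs) ∎
    where open ≤-Reasoning
  ... | false = begin
    degree y zs + edges zs                ≤⟨ +-mono-≤ (≤-reflexive y-twin-of-x) (edges≤degree*length x zs) ⟩
    degree x zs + degree x zs * length zs ≡⟨ *-suc (degree x zs) (length zs) ⟨
    degree x zs * suc (length zs)         ∎
    where
    open ≤-Reasoning
    y-twin-of-x : degree y zs ≡ degree x zs
    y-twin-of-x = countB-cong (λ z → nonadjacent-twins x y z xy) zs

  ≼-∷ : ∀ x zs → zs ≼ (x ∷ zs)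
  ≼-∷ x zs = begin
    edges zs * suc (length zs)                     ≡⟨ *-suc (edges zs) (length zs) ⟩
    edges zs + edges zs * length zs                ≤⟨ +-monoˡ-≤ _ (edges≤degree*length x zs) ⟩
    degree x zs * length zs + edges zs * length zs ≡⟨ *-distribʳ-+ (length zs) (degree x zs) (edges zs) ⟨
    edges (x ∷ zs) * length zs                     ∎
    where open ≤-Reasoning

  ≼-insert : ∀ us x vs → (us ++ vs) ≼ (us ++ x ∷ vs)
  ≼-insert us x vs =
    subst₂ (λ e n → edges (us ++ vs) * n ≤ e * length (us ++ vs))
      (sym (edges-insert us x vs)) (sym (length-++-sucʳ us x vs)) (≼-∷ x (us ++ vs))

  ≼-trans : ∀ zs ys xs .{{_ : NonZero (length ys)}} → zs ≼ ys → ys ≼ xs → zs ≼ xs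
  ≼-trans zs ys xs = cross-≤-trans (edges zs) (edges ys) (edges xs) (length zs) (length ys) (length xs)

  ++-⊆⇒≼ : ∀ us {ys xs} → ys ⊆ xs → (us ++ ys) ≼ (us ++ xs)
  ++-⊆⇒≼ us                            []         = ≤-refl
  ++-⊆⇒≼ us       {x ∷ ys} {_ ∷ xs}     (refl ∷ p) =
    subst₂ _≼_ (++-assoc us [ x ] ys) (++-assoc us [ x ] xs) (++-⊆⇒≼ (us ++ [ x ]) p)
  ++-⊆⇒≼ []                            (x ∷ʳ [])  = z≤n
  ++-⊆⇒≼ []       {ys} {_ ∷ xs@(_ ∷ _)} (x ∷ʳ p)   =
    ≼-trans ys xs (x ∷ xs) (++-⊆⇒≼ [] p) (≼-insert [] x xs)
  ++-⊆⇒≼ (u ∷ us) {ys} {_ ∷ xs}         (x ∷ʳ p)   =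
    ≼-trans (u ∷ us ++ ys) (u ∷ us ++ xs) (u ∷ us ++ x ∷ xs) (++-⊆⇒≼ (u ∷ us) p) (≼-insert (u ∷ us) x xs)

  ⊆⇒≼ : ∀ {ys xs} → ys ⊆ xs → ys ≼ xs
  ⊆⇒≼ = ++-⊆⇒≼ []

  countB-pairsOf≤edges-filterᵇ : (q : A → Bool) (P : A → A → Bool) →
    (∀ u v → T (P u v) → T (q u) × T (q v) × T (adj u v)) →
    (xs : List A) → countB (uncurry′ P) (pairsOf xs) ≤ edges (filterᵇ q xs)
  countB-pairsOf≤edges-filterᵇ q P P⇒q∧q∧adj []       = z≤n
  countB-pairsOf≤edges-filterᵇ q P P⇒q∧q∧adj (x ∷ xs) with q x in qx
  ... | true  = begin
    countB (uncurry′ P) (pairsOf (x ∷ xs))             ≡⟨ countB-pairsOf-∷ P x xs ⟩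
    countB (P x) xs + countB (uncurry′ P) (pairsOf xs) ≤⟨ +-mono-≤ row rest ⟩
    degree x (filterᵇ q xs) + edges (filterᵇ q xs)    ∎
    where
    open ≤-Reasoning
    rest : countB (uncurry′ P) (pairsOf xs) ≤ edges (filterᵇ q xs)
    rest = countB-pairsOf≤edges-filterᵇ q P P⇒q∧q∧adj xs
    row : countB (P x) xs ≤ degree x (filterᵇ q xs)
    row = ≤-trans
      (countB-mono (λ v Pxv → let _ , qv , adjxv = P⇒q∧q∧adj x v Pxv in Equivalence.from T-∧ (qv , adjxv)) xs)
      (≤-reflexive (sym (countB-filterᵇ (adj x) q xs)))
  ... | false = begin
    countB (uncurry′ P) (pairsOf (x ∷ xs))             ≡⟨ countB-pairsOf-∷ P x xs ⟩
    countB (P x) xs + countB (uncurry′ P) (pairsOf xs) ≡⟨ cong (_+ _) (countB-none ¬Px xs) ⟩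
    countB (uncurry′ P) (pairsOf xs)                   ≤⟨ countB-pairsOf≤edges-filterᵇ q P P⇒q∧q∧adj xs ⟩
    edges (filterᵇ q xs)                               ∎
    where
    open ≤-Reasoning
    ¬Px : ∀ v → ¬ T (P x v)
    ¬Px v Pxv = subst T qx (proj₁ (P⇒q∧q∧adj x v Pxv))

ratio2-cong : ∀ e {v v'} → v ≡ v' → (p : 0 < v) (p' : 0 < v') → ratio2 e v p ≡ ratio2 e v' p'
ratio2-cong e refl p p' = refl

cross-≤⇒ratio2-≤ : ∀ a b c d (pb : 0 < b) (pd : 0 < d) → a * d ≤ c * b → ratio2 a b pb ≤ℚ ratio2 c d pd
cross-≤⇒ratio2-≤ a (suc b) c (suc d) pb pd ad≤cb =
  toℚᵘ-cancel-≤ (≤-respʳ-≃ (≃-sym (toℚᵘ-fromℚᵘ q)) (≤-respˡ-≃ (≃-sym (toℚᵘ-fromℚᵘ p)) p≤q))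
  where
  p q : ℚᵘ.ℚᵘ
  p = mkℚᵘ (ℤ.+ (2 * a)) b
  q = mkℚᵘ (ℤ.+ (2 * c)) d
  2ad≤2cb : 2 * a * suc d ≤ 2 * c * suc b
  2ad≤2cb = subst₂ _≤_ (sym (*-assoc 2 a (suc d))) (sym (*-assoc 2 c (suc b))) (*-monoʳ-≤ 2 ad≤cb)
  p≤q : p ℚᵘ.≤ q
  p≤q = *≤* (subst₂ ℤ._≤_ (pos-* (2 * a) (suc d)) (pos-* (2 * c) (suc b)) (+≤+ 2ad≤2cb))

module _ {r : ℕ} {s : Fin r → ℕ} where

  adjK-sym : (u v : Vtx r s) → adjK u v ≡ adjK v u
  adjK-sym (i , _) (j , _) with i ≟ j | j ≟ i
  ... | yes _   | yes _   = refl
  ... | no _    | no _    = refl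
  ... | yes i≡j | no j≢i  = ⊥-elim (j≢i (sym i≡j))
  ... | no i≢j  | yes j≡i = ⊥-elim (i≢j (sym j≡i))

  adjK-nonadjacent-twins : (x y z : Vtx r s) → adjK x y ≡ false → adjK y z ≡ adjK x z
  adjK-nonadjacent-twins (i , _) (j , _) z xy with i ≟ j
  adjK-nonadjacent-twins (i , _) (i , _) z xy | yes refl = refl
  adjK-nonadjacent-twins (i , _) (j , _) z () | no _

complete : (r : ℕ) (s : Fin r → ℕ) → Subgraph r s
complete r s = record
  { inV = λ _ → true ; inE = adjK ; symE = adjK-sym
  ; edgeK = λ _ _ uv → uv ; endL = λ _ _ _ → tt ; endR = λ _ _ _ → tt }

vF-complete : (r : ℕ) (s : Fin r → ℕ) → vF (complete r s) ≡ vK r s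
vF-complete r s = countB-true (allV r s)

eF*vK≤eK*vF : {r : ℕ} {s : Fin r → ℕ} (F : Subgraph r s) → eF F * vK r s ≤ eK r s * vF F
eF*vK≤eK*vF {r} {s} F = begin
  eF F * length V                      ≤⟨ *-monoˡ-≤ (length V) F≤F[V] ⟩
  edges (filterᵇ (inV F) V) * length V ≤⟨ ⊆⇒≼ (filter-⊆ (T? ∘ inV F) V) ⟩
  edges V * length (filterᵇ (inV F) V) ≡⟨ cong₂ _*_ (sym (countB-pairsOf≡edges V)) (length-filterᵇ (inV F) V) ⟩
  eK r s * vF F                        ∎
  where
  open ≤-Reasoning
  open CompleteMultipartite adjK adjK-sym adjK-nonadjacent-twins
  V : List (Vtx r s)
  V = allV r s
  F≤F[V] : eF F ≤ edges (filterᵇ (inV F) V)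
  F≤F[V] = countB-pairsOf≤edges-filterᵇ (inV F) (inE F) (λ u v uv → endL F u v uv , endR F u v uv , edgeK F u v uv) V

lemma2p5 : (r : ℕ) → 2 ≤ r → (s : Fin r → ℕ)
    → (∀ i → 1 ≤ s i)
    → (∀ i j → i ≤F j → s i ≤ s j)
    → (pK : 0 < vK r s)
    → Σ (Subgraph r s) (λ F → Σ (0 < vF F) (λ pF → ratio2 (eF F) (vF F) pF ≡ ratio2 (eK r s) (vK r s) pK))
    × (∀ (F : Subgraph r s) (pF : 0 < vF F) → ratio2 (eF F) (vF F) pF ≤ℚ ratio2 (eK r s) (vK r s) pK)
lemma2p5 r _ s _ _ pK =
  (complete r s , pK′ , ratio2-cong (eK r s) (vF-complete r s) pK′ pK) ,
  λ F pF → cross-≤⇒ratio2-≤ (eF F) (vF F) (eK r s) (vK r s) pF pK (eF*vK≤eK*vF F)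
  where
  pK′ : 0 < vF (complete r s)
  pK′ = subst (0 <_) (sym (vF-complete r s)) pK
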